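{- Let $0<1/n\ll\alpha\ll\varepsilon\ll 1/r$ where $n,r\in\mathbb N$ and $r\ge 2$. Suppose that $G$ is a digraph on $n$ vertices such that for every $x\in V(G)$, $d^+(x)\ge\left(1-\frac{1}{r-1}-\varepsilon\right)n$ or $d^-(x)\ge\left(1-\frac{1}{r-1}-\varepsilon\right)n$. Further suppose that $G$ contains at most $\alpha n^r$ copies of $T_r$. Then $G$ contains a $\sqrt{\varepsilon}$-independent set of size at least $n/(r-1)$.
   Context: Hierarchy notation: $0<a\ll b\ll c$ means the constants are chosen from right to left, each sufficiently small in terms of those to its right. A digraph has no loops and at most one edge in each direction between any two vertices; $d^\pm(x)$ are out-/indegree. $T_r$ is the transitive tournament on $r$ vertices. For $G$ on $n$ vertices, $S\subseteq V(G)$ is $\beta$-independent if $G[S]$ has at most $\beta n^2$ edges.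
   Formalization: The hierarchy constants ε and α range only over the positive rationals. -}

module Defs where

open import Data.Nat as ℕ using (ℕ; zero; suc; _<ᵇ_)
open import Data.Integer using (+_)
open import Data.Rational using (ℚ; _/_; _*_; _-_; 1ℚ)
open import Data.Bool using (Bool; true; false; _∧_; _∨_; not; if_then_else_)
open import Data.Fin using (Fin; toℕ)
open import Data.List using (List; []; _∷_; map; concatMap; allFin)
open import Data.Bool.ListAction using (and)
open import Data.Nat.ListAction using (sum)
open import Data.Vec using (lookup)
import Data.Vec.Functional as VF
open import Data.Fin.Subset using (Subset)
open import Relation.Binary.PropositionalEquality using (_≡_)

-- A digraph on vertex set Fin n: adjacency x → y given by a Boolean,
-- no loops; the two directions between x and y are independent, so there is
-- at most one edge in each direction.
record Digraph (n : ℕ) : Set where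
  field
    adj      : Fin n → Fin n → Bool
    loopless : ∀ x → adj x x ≡ false
open Digraph public

countB : {A : Set} → (A → Bool) → List A → ℕ
countB p []       = 0
countB p (a ∷ as) = if p a then suc (countB p as) else countB p as

ℕtoℚ : ℕ → ℚ
ℕtoℚ m = + m / 1

outdeg : {n : ℕ} → Digraph n → Fin n → ℕ
outdeg {n} G x = countB (λ y → adj G x y) (allFin n)

indeg : {n : ℕ} → Digraph n → Fin n → ℕ
indeg {n} G x = countB (λ y → adj G y x) (allFin n)

edgesIn : {n : ℕ} → Digraph n → Subset n → ℕ
edgesIn {n} G S =
  sum (map (λ x → countB (λ y → lookup S x ∧ lookup S y ∧ adj G x y) (allFin n)) (allFin n))

allTuples : (r n : ℕ) → List (Fin r → Fin n)
allTuples zero    n = (λ ()) ∷ []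
allTuples (suc r) n = concatMap (λ f → map (λ v → v VF.∷ f) (allFin n)) (allTuples r n)

-- f : Fin r → Fin n spans a copy of T_r with f i → f j whenever i < j
-- (such f is automatically injective since G has no loops; T_r has trivial
-- automorphism group, so these tuples are in bijection with copies of T_r)
isTT : {r n : ℕ} → Digraph n → (Fin r → Fin n) → Bool
isTT {r} G f =
  and (map (λ i → and (map (λ j → not (toℕ i <ᵇ toℕ j) ∨ adj G (f i) (f j)) (allFin r))) (allFin r))

copiesTT : {n : ℕ} → (r : ℕ) → Digraph n → ℕ
copiesTT {n} r G = countB (isTT G) (allTuples r n)

-- the quantity (1 - 1/(r-1) - ε) n, for r ≥ 2 (value for r < 2 irrelevant)
threshold : ℕ → ℚ → ℕ → ℚ
threshold (suc (suc k)) ε n = (1ℚ - (+ 1 / suc k) - ε) * ℕtoℚ n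
threshold _             ε n = ℕtoℚ n

-- S is √ε-independent: G[S] has at most √ε n² edges.  Since √ε is in
-- general irrational and both sides are nonnegative, this is stated
-- equivalently as e(G[S])² ≤ ε n⁴.
IsSqrtIndependent : {n : ℕ} → Digraph n → ℚ → Subset n → Set
IsSqrtIndependent {n} G ε S =
  ℕtoℚ (edgesIn G S) * ℕtoℚ (edgesIn G S) Data.Rational.≤ ε * ℕtoℚ ((n ℕ.* n) ℕ.* (n ℕ.* n))
  where import Data.Rational

module Submission where

-- Proposition 6.6.  Let K = r - 1, ε = a/b and α = c/d.  Every vertex v has
-- a neighbourhood N(v) (its out- or in-neighbourhood) missing at most
-- D ≈ (1/K + ε)n vertices.  Greedy step: inside the current set U pick
-- v ∈ U whose neighbourhood U ∩ N(v) contains at most the average number of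
-- copies of T_m, and pass to U ∩ N(v).  A T_{m+1} of U is seen only from its
-- source and from its sink, so this at most doubles the count; after r - 2
-- steps we reach W with |W| ≥ n - (r-2)D and e(W)·L^{r-2} ≤ 2^{r-2}·#T_r,
-- where L ≥ n/(2K), hence e(W) ≤ n²/b when α is small.  Adding at most
-- 1 + (r-2)εn vertices to W gives a set of size ⌈n/K⌉ with at most 4Kεn²
-- edges, and 16K²ε ≤ 1 turns this into e ≤ √ε n².

open import Defs
open import Data.Nat using (ℕ; zero; suc; _+_; _*_; _^_; _∸_; _≤_; z≤n; s≤s; _<ᵇ_; _≡ᵇ_; _≤?_; NonZero; >-nonZero)
open import Data.Nat.Properties
open import Data.Nat.DivMod using (_/_; _%_; m/n*n≤m; m*n/n≡m; /-monoˡ-≤; m≡m%n+[m/n]*n; m%n<n)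
open import Data.Nat.Tactic.RingSolver using (solve-∀)
import Data.Nat.ListAction as ListSum
open import Data.Bool using (Bool; true; false; _∧_; _∨_; not)
open import Data.Bool.Properties using (∧-assoc; ∧-comm; ∧-identityʳ; ∧-zeroʳ; ∨-identityʳ; ∨-zeroʳ)
open import Data.Bool.ListAction using (and)
open import Data.Fin using (Fin; zero; suc; toℕ)
open import Data.Fin.Subset using (Subset; ∣_∣)
import Data.Vec as Vec
open import Data.Vec.Properties using (lookup∘tabulate)
import Data.Vec.Functional as VF
open import Data.List using (List; []; _∷_; _++_; map; concatMap; tabulate; allFin)
open import Data.List.Properties using (map-tabulate)
open import Data.Product using (Σ; _×_; _,_; proj₁; proj₂)
open import Data.Sum using (_⊎_; inj₁; inj₂)
open import Data.Rational as ℚ using (ℚ; 0ℚ) renaming (_<_ to _<ℚ_; _≤_ to _≤ℚ_; _*_ to _*ℚ_)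
open import Relation.Binary.PropositionalEquality
open import Relation.Nullary using (¬_; Dec; yes; no; contradiction)
open import Function using (_∘_)
open import Algebra.Properties.Semiring.Sum +-*-semiring
  using (sum; sum-syntax; sum-cong-≗; sum-replicate-zero; ∑-distrib-+; ∑-comm; *-distribˡ-sum)

𝟙 : Bool → ℕ
𝟙 true  = 1
𝟙 false = 0

𝟙≤1 : ∀ b → 𝟙 b ≤ 1
𝟙≤1 true  = ≤-refl
𝟙≤1 false = z≤n

𝟙-∧ : ∀ a b → 𝟙 (a ∧ b) ≡ 𝟙 a * 𝟙 b
𝟙-∧ true  b = sym (+-identityʳ (𝟙 b))
𝟙-∧ false b = refl

𝟙-∧-* : ∀ a b x → 𝟙 a * (𝟙 b * x) ≡ 𝟙 (a ∧ b) * x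
𝟙-∧-* true  b x = +-identityʳ (𝟙 b * x)
𝟙-∧-* false b x = refl

𝟙-∧-+ : ∀ a b → 𝟙 a + 𝟙 b ≤ 𝟙 (a ∧ b) + 1
𝟙-∧-+ true  b     = ≤-reflexive (+-comm 1 (𝟙 b))
𝟙-∧-+ false true  = ≤-refl
𝟙-∧-+ false false = z≤n

sum-mono : ∀ {m} {f g : Fin m → ℕ} → (∀ i → f i ≤ g i) → sum f ≤ sum g
sum-mono {zero}  f≤g = z≤n
sum-mono {suc m} f≤g = +-mono-≤ (f≤g zero) (sum-mono (f≤g ∘ suc))

count : ∀ {m} → (Fin m → Bool) → ℕ
count {m} p = ∑[ i < m ] 𝟙 (p i)

count-cong : ∀ {m} {p q : Fin m → Bool} → (∀ i → p i ≡ q i) → count p ≡ count q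
count-cong p≗q = sum-cong-≗ (cong 𝟙 ∘ p≗q)

count-all : ∀ m → count {m} (λ _ → true) ≡ m
count-all zero    = refl
count-all (suc m) = cong suc (count-all m)

count-none : ∀ {m} (p : Fin m → Bool) → (∀ i → p i ≡ false) → count p ≡ 0
count-none {zero}  p none = refl
count-none {suc m} p none rewrite none zero = count-none (p ∘ suc) (none ∘ suc)

∣tabulate∣ : ∀ {m} (W : Fin m → Bool) → ∣ Vec.tabulate W ∣ ≡ count W
∣tabulate∣ {zero}  W = refl
∣tabulate∣ {suc m} W with W zero
... | true  = cong suc (∣tabulate∣ (W ∘ suc))
... | false = ∣tabulate∣ (W ∘ suc)

countB-tabulate : ∀ {m} {A : Set} (p : A → Bool) (f : Fin m → A) → countB p (tabulate f) ≡ count (p ∘ f)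
countB-tabulate {zero}  p f = refl
countB-tabulate {suc m} p f with p (f zero)
... | true  = cong suc (countB-tabulate p (f ∘ suc))
... | false = countB-tabulate p (f ∘ suc)

countB-allFin : ∀ {m} (p : Fin m → Bool) → countB p (allFin m) ≡ count p
countB-allFin p = countB-tabulate p (λ i → i)

sum-map-tabulate : ∀ {m} {A : Set} (h : Fin m → A) (g : A → ℕ) → ListSum.sum (map g (tabulate h)) ≡ sum (g ∘ h)
sum-map-tabulate {zero}  h g = refl
sum-map-tabulate {suc m} h g = cong (g (h zero) +_) (sum-map-tabulate (h ∘ suc) g)

∑ᴸ : {A : Set} → List A → (A → ℕ) → ℕ
∑ᴸ []       g = 0
∑ᴸ (x ∷ xs) g = g x + ∑ᴸ xs g

countB-∑ᴸ : {A : Set} (p : A → Bool) (xs : List A) → countB p xs ≡ ∑ᴸ xs (𝟙 ∘ p)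
countB-∑ᴸ p []       = refl
countB-∑ᴸ p (x ∷ xs) with p x
... | true  = cong suc (countB-∑ᴸ p xs)
... | false = countB-∑ᴸ p xs

∑ᴸ-cong : {A : Set} (xs : List A) {g h : A → ℕ} → (∀ x → g x ≡ h x) → ∑ᴸ xs g ≡ ∑ᴸ xs h
∑ᴸ-cong []       g≗h = refl
∑ᴸ-cong (x ∷ xs) g≗h = cong₂ _+_ (g≗h x) (∑ᴸ-cong xs g≗h)

countB-cong : {A : Set} {p q : A → Bool} (xs : List A) → (∀ x → p x ≡ q x) → countB p xs ≡ countB q xs
countB-cong {p = p} {q} xs p≗q =
  trans (countB-∑ᴸ p xs) (trans (∑ᴸ-cong xs (cong 𝟙 ∘ p≗q)) (sym (countB-∑ᴸ q xs)))

countB-++ : {A : Set} (p : A → Bool) (xs ys : List A) → countB p (xs ++ ys) ≡ countB p xs + countB p ys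
countB-++ p []       ys = refl
countB-++ p (x ∷ xs) ys with p x
... | true  = cong suc (countB-++ p xs ys)
... | false = countB-++ p xs ys

countB-concatMap : {A B : Set} (p : B → Bool) (f : A → List B) (xs : List A) →
  countB p (concatMap f xs) ≡ ∑ᴸ xs (λ x → countB p (f x))
countB-concatMap p f []       = refl
countB-concatMap p f (x ∷ xs) =
  trans (countB-++ p (f x) (concatMap f xs)) (cong (countB p (f x) +_) (countB-concatMap p f xs))

∑ᴸ-* : {A : Set} (xs : List A) (c : ℕ) (g : A → ℕ) → ∑ᴸ xs (λ x → c * g x) ≡ c * ∑ᴸ xs g
∑ᴸ-* []       c g = sym (*-zeroʳ c)
∑ᴸ-* (x ∷ xs) c g = trans (cong (c * g x +_) (∑ᴸ-* xs c g)) (sym (*-distribˡ-+ c (g x) (∑ᴸ xs g)))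

∑ᴸ-∑ : ∀ {m} {A : Set} (xs : List A) (f : Fin m → A → ℕ) →
  ∑ᴸ xs (λ x → ∑[ i < m ] f i x) ≡ ∑[ i < m ] ∑ᴸ xs (f i)
∑ᴸ-∑ {m} []       f = sym (sum-replicate-zero m)
∑ᴸ-∑ {m} (x ∷ xs) f =
  trans (cong (∑[ i < m ] f i x +_) (∑ᴸ-∑ xs f)) (sym (∑-distrib-+ (λ i → f i x) (λ i → ∑ᴸ xs (f i))))

_∩_ : ∀ {m} → (Fin m → Bool) → (Fin m → Bool) → (Fin m → Bool)
(U ∩ V) i = U i ∧ V i

count-∩ : ∀ {m} (U V : Fin m → Bool) → count U + count V ≤ count (U ∩ V) + m
count-∩ {m} U V = begin
  count U + count V                       ≡⟨ ∑-distrib-+ (𝟙 ∘ U) (𝟙 ∘ V) ⟨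
  ∑[ i < m ] (𝟙 (U i) + 𝟙 (V i))          ≤⟨ sum-mono (λ i → 𝟙-∧-+ (U i) (V i)) ⟩
  ∑[ i < m ] (𝟙 ((U ∩ V) i) + 1)          ≡⟨ ∑-distrib-+ (𝟙 ∘ (U ∩ V)) (λ _ → 1) ⟩
  count (U ∩ V) + count {m} (λ _ → true)  ≡⟨ cong (count (U ∩ V) +_) (count-all m) ⟩
  count (U ∩ V) + m                       ∎
  where open ≤-Reasoning

∧-swap : ∀ a b c → a ∧ (b ∧ c) ≡ b ∧ (a ∧ c)
∧-swap a b c = trans (sym (∧-assoc a b c)) (trans (cong (_∧ c) (∧-comm a b)) (∧-assoc b a c))

every : ∀ {m} → (Fin m → Bool) → Bool
every {zero}  p = true
every {suc m} p = p zero ∧ every (p ∘ suc)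

every-∧ : ∀ {m} (p q : Fin m → Bool) → every p ∧ every q ≡ every (p ∩ q)
every-∧ {zero}  p q = refl
every-∧ {suc m} p q = begin
  (p zero ∧ every (p ∘ suc)) ∧ (q zero ∧ every (q ∘ suc))   ≡⟨ ∧-assoc (p zero) _ _ ⟩
  p zero ∧ (every (p ∘ suc) ∧ (q zero ∧ every (q ∘ suc)))   ≡⟨ cong (p zero ∧_) (∧-swap (every (p ∘ suc)) (q zero) _) ⟩
  p zero ∧ (q zero ∧ (every (p ∘ suc) ∧ every (q ∘ suc)))   ≡⟨ ∧-assoc (p zero) (q zero) _ ⟨
  (p zero ∧ q zero) ∧ (every (p ∘ suc) ∧ every (q ∘ suc))   ≡⟨ cong ((p zero ∧ q zero) ∧_) (every-∧ (p ∘ suc) (q ∘ suc)) ⟩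
  (p zero ∧ q zero) ∧ every ((p ∘ suc) ∩ (q ∘ suc))         ∎
  where open ≡-Reasoning

every-cong : ∀ {m} {p q : Fin m → Bool} → (∀ i → p i ≡ q i) → every p ≡ every q
every-cong {zero}  p≗q = refl
every-cong {suc m} p≗q = cong₂ _∧_ (p≗q zero) (every-cong (p≗q ∘ suc))

every-tabulate : ∀ {m} {A : Set} (h : Fin m → A) (p : A → Bool) → and (map p (tabulate h)) ≡ every (p ∘ h)
every-tabulate {zero}  h p = refl
every-tabulate {suc m} h p = cong (p (h zero) ∧_) (every-tabulate (h ∘ suc) p)

every-true : ∀ m → every {m} (λ _ → true) ≡ true
every-true zero    = refl
every-true (suc m) = every-true m

module _ {n : ℕ} (G : Digraph n) where

  N⁺ N⁻ : Fin n → Fin n → Bool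
  N⁺ v u = adj G v u
  N⁻ v u = adj G u v

  -- Number of copies of T_m inside U, built by choosing the source first
  -- (TT⁺) or the sink first (TT⁻).
  TT⁺ TT⁻ : ℕ → (Fin n → Bool) → ℕ
  TT⁺ zero    U = 1
  TT⁺ (suc m) U = ∑[ v < n ] (𝟙 (U v) * TT⁺ m (U ∩ N⁺ v))
  TT⁻ zero    U = 1
  TT⁻ (suc m) U = ∑[ v < n ] (𝟙 (U v) * TT⁻ m (U ∩ N⁻ v))

  TT⁺-cong : ∀ m {U V : Fin n → Bool} → (∀ u → U u ≡ V u) → TT⁺ m U ≡ TT⁺ m V
  TT⁺-cong zero    U≗V = refl
  TT⁺-cong (suc m) U≗V =
    sum-cong-≗ (λ v → cong₂ _*_ (cong 𝟙 (U≗V v)) (TT⁺-cong m (λ u → cong (_∧ N⁺ v u) (U≗V u))))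

  -- T_{m+2}'s in U with source v and sink w
  sourceSink : ℕ → (Fin n → Bool) → Fin n → Fin n → ℕ
  sourceSink m U v w = 𝟙 (U v ∧ (U w ∧ adj G v w)) * TT⁺ m ((U ∩ N⁺ v) ∩ N⁻ w)

  TT⁺-sourceSink : ∀ m U → (∀ V → TT⁺ (suc m) V ≡ TT⁻ (suc m) V) → (∀ V → TT⁺ m V ≡ TT⁻ m V) →
    TT⁺ (2 + m) U ≡ ∑[ v < n ] ∑[ w < n ] sourceSink m U v w
  TT⁺-sourceSink m U IH₁ IH₀ = begin
    TT⁺ (2 + m) U
      ≡⟨ sum-cong-≗ (λ v → cong (𝟙 (U v) *_) (IH₁ (U ∩ N⁺ v))) ⟩
    ∑[ v < n ] (𝟙 (U v) * TT⁻ (suc m) (U ∩ N⁺ v))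
      ≡⟨ sum-cong-≗ (λ v → *-distribˡ-sum {n} (𝟙 (U v)) _) ⟩
    ∑[ v < n ] ∑[ w < n ] (𝟙 (U v) * (𝟙 ((U ∩ N⁺ v) w) * TT⁻ m ((U ∩ N⁺ v) ∩ N⁻ w)))
      ≡⟨ sum-cong-≗ (λ v → sum-cong-≗ (λ w →
           trans (𝟙-∧-* (U v) _ _) (cong (𝟙 (U v ∧ (U w ∧ adj G v w)) *_) (sym (IH₀ _))))) ⟩
    ∑[ v < n ] ∑[ w < n ] sourceSink m U v w ∎
    where open ≡-Reasoning

  TT⁻-sourceSink : ∀ m U → (∀ V → TT⁺ (suc m) V ≡ TT⁻ (suc m) V) →
    TT⁻ (2 + m) U ≡ ∑[ w < n ] ∑[ v < n ] sourceSink m U v w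
  TT⁻-sourceSink m U IH₁ = begin
    TT⁻ (2 + m) U
      ≡⟨ sum-cong-≗ (λ w → cong (𝟙 (U w) *_) (IH₁ (U ∩ N⁻ w))) ⟨
    ∑[ w < n ] (𝟙 (U w) * TT⁺ (suc m) (U ∩ N⁻ w))
      ≡⟨ sum-cong-≗ (λ w → *-distribˡ-sum {n} (𝟙 (U w)) _) ⟩
    ∑[ w < n ] ∑[ v < n ] (𝟙 (U w) * (𝟙 ((U ∩ N⁻ w) v) * TT⁺ m ((U ∩ N⁻ w) ∩ N⁺ v)))
      ≡⟨ sum-cong-≗ (λ w → sum-cong-≗ (λ v →
           trans (𝟙-∧-* (U w) _ _) (cong₂ _*_ (cong 𝟙 (∧-swap (U w) (U v) _)) (TT⁺-cong m (λ u → exchange (U u)))))) ⟩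
    ∑[ w < n ] ∑[ v < n ] sourceSink m U v w ∎
    where
    open ≡-Reasoning
    exchange : ∀ {a b} c → (c ∧ a) ∧ b ≡ (c ∧ b) ∧ a
    exchange {a} {b} c = trans (∧-assoc c a b) (trans (cong (c ∧_) (∧-comm a b)) (sym (∧-assoc c b a)))

  -- both recursions count the same tournaments (double counting by source and sink)
  TT⁺≡TT⁻ : ∀ m U → TT⁺ m U ≡ TT⁻ m U
  TT⁺≡TT⁻ zero          U = refl
  TT⁺≡TT⁻ (suc zero)    U = refl
  TT⁺≡TT⁻ (suc (suc m)) U = begin
    TT⁺ (2 + m) U                             ≡⟨ TT⁺-sourceSink m U (TT⁺≡TT⁻ (suc m)) (TT⁺≡TT⁻ m) ⟩
    ∑[ v < n ] ∑[ w < n ] sourceSink m U v w  ≡⟨ ∑-comm (sourceSink m U) ⟩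
    ∑[ w < n ] ∑[ v < n ] sourceSink m U v w  ≡⟨ TT⁻-sourceSink m U (TT⁺≡TT⁻ (suc m)) ⟨
    TT⁻ (2 + m) U                             ∎
    where open ≡-Reasoning

  transitive : ∀ {m} → (Fin m → Fin n) → Bool
  transitive {m} f = every (λ i → every (λ j → not (toℕ i <ᵇ toℕ j) ∨ adj G (f i) (f j)))

  isTT≡transitive : ∀ {m} (f : Fin m → Fin n) → isTT G f ≡ transitive f
  isTT≡transitive {m} f = trans (every-tabulate {m} (λ i → i) _)
    (every-cong (λ i → every-tabulate {m} (λ j → j) (λ j → not (toℕ i <ᵇ toℕ j) ∨ adj G (f i) (f j))))

  tuplesIn : ℕ → (Fin n → Bool) → ℕ
  tuplesIn m U = countB (λ f → transitive f ∧ every (U ∘ f)) (allTuples m n)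

  transitive-∷ : ∀ {m} U v (f : Fin m → Fin n) →
    transitive (v VF.∷ f) ∧ every (U ∘ (v VF.∷ f)) ≡ U v ∧ (transitive f ∧ every ((U ∩ N⁺ v) ∘ f))
  transitive-∷ U v f = trans (rearrange (every (N⁺ v ∘ f)) (transitive f) (U v) (every (U ∘ f)))
                             (cong (λ b → U v ∧ (transitive f ∧ b)) (every-∧ (U ∘ f) (N⁺ v ∘ f)))
    where
    rearrange : ∀ a t u b → (a ∧ t) ∧ (u ∧ b) ≡ u ∧ (t ∧ (b ∧ a))
    rearrange true  true  u b = cong (u ∧_) (sym (∧-identityʳ b))
    rearrange true  false u b = sym (∧-zeroʳ u)
    rearrange false t     u b = sym (trans (cong (λ x → u ∧ (t ∧ x)) (∧-zeroʳ b))
                                      (trans (cong (u ∧_) (∧-zeroʳ t)) (∧-zeroʳ u)))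

  tuplesIn≡TT⁺ : ∀ m U → tuplesIn m U ≡ TT⁺ m U
  tuplesIn≡TT⁺ zero    U = refl
  tuplesIn≡TT⁺ (suc m) U = begin
    tuplesIn (suc m) U
      ≡⟨ countB-concatMap _ (λ f → map (λ v → v VF.∷ f) (allFin n)) L ⟩
    ∑ᴸ L (λ f → countB inU (map (λ v → v VF.∷ f) (allFin n)))
      ≡⟨ ∑ᴸ-cong L (λ f → trans (cong (countB inU) (map-tabulate {n = n} (λ v → v) (λ v → v VF.∷ f))) (countB-tabulate {n} inU _)) ⟩
    ∑ᴸ L (λ f → count (λ v → inU (v VF.∷ f)))
      ≡⟨ ∑ᴸ-cong L (λ f → sum-cong-≗ (λ v → trans (cong 𝟙 (transitive-∷ U v f)) (𝟙-∧ (U v) _))) ⟩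
    ∑ᴸ L (λ f → ∑[ v < n ] (𝟙 (U v) * 𝟙 (inN⁺ v f)))
      ≡⟨ ∑ᴸ-∑ {n} L _ ⟩
    ∑[ v < n ] ∑ᴸ L (λ f → 𝟙 (U v) * 𝟙 (inN⁺ v f))
      ≡⟨ sum-cong-≗ {n} (λ v → trans (∑ᴸ-* L (𝟙 (U v)) _)
           (cong (𝟙 (U v) *_) (trans (sym (countB-∑ᴸ (inN⁺ v) L)) (tuplesIn≡TT⁺ m (U ∩ N⁺ v))))) ⟩
    TT⁺ (suc m) U ∎
    where
    open ≡-Reasoning
    L : List (Fin m → Fin n)
    L = allTuples m n
    inU : (Fin (suc m) → Fin n) → Bool
    inU f = transitive f ∧ every (U ∘ f)
    inN⁺ : Fin n → (Fin m → Fin n) → Bool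
    inN⁺ v f = transitive f ∧ every ((U ∩ N⁺ v) ∘ f)

  copiesTT≡TT⁺ : ∀ r → copiesTT r G ≡ TT⁺ r (λ _ → true)
  copiesTT≡TT⁺ r = trans (countB-cong (allTuples r n) (λ f →
                     trans (isTT≡transitive f) (sym (trans (cong (transitive f ∧_) (every-true r)) (∧-identityʳ _)))))
                   (tuplesIn≡TT⁺ r (λ _ → true))

  edges : (Fin n → Bool) → ℕ
  edges W = ∑[ x < n ] count (λ y → W x ∧ (W y ∧ adj G x y))

  edgesIn≡edges : (S : Subset n) → edgesIn G S ≡ edges (Vec.lookup S)
  edgesIn≡edges S = trans (sum-map-tabulate {n} (λ x → x) _) (sum-cong-≗ {n} (λ x → countB-allFin {n} _))

  edges-cong : ∀ {W V} → (∀ u → W u ≡ V u) → edges W ≡ edges V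
  edges-cong W≗V = sum-cong-≗ (λ x → count-cong (λ y → cong₂ (λ p q → p ∧ (q ∧ adj G x y)) (W≗V x) (W≗V y)))

  TT⁺2≡edges : ∀ W → TT⁺ 2 W ≡ edges W
  TT⁺2≡edges W = sum-cong-≗ (λ v → trans (*-distribˡ-sum {n} (𝟙 (W v)) _)
                                        (sum-cong-≗ (λ w → 𝟙-∧-*1 (W v) (W w ∧ adj G v w))))
    where
    𝟙-∧-*1 : ∀ a b → 𝟙 a * (𝟙 b * 1) ≡ 𝟙 (a ∧ b)
    𝟙-∧-*1 a b = trans (𝟙-∧-* a b 1) (*-identityʳ _)

minimum : ∀ {m} (U : Fin m → Bool) (g : Fin m → ℕ) →
  (∀ w → U w ≡ false) ⊎ Σ (Fin m) λ v → U v ≡ true × (∀ w → U w ≡ true → g v ≤ g w)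
minimum {zero}  U g = inj₁ (λ ())
minimum {suc m} U g with U zero in U₀ | minimum (U ∘ suc) (g ∘ suc)
... | false | inj₁ none = inj₁ λ { zero → U₀ ; (suc w) → none w }
... | true  | inj₁ none = inj₂ (zero , U₀ , λ { zero _ → ≤-refl ; (suc w) Uw → contradiction (trans (sym (none w)) Uw) λ () })
... | false | inj₂ (v , Uv , min) = inj₂ (suc v , Uv , λ { zero U₀′ → contradiction (trans (sym U₀) U₀′) λ () ; (suc w) → min w })
... | true  | inj₂ (v , Uv , min) with g zero ≤? g (suc v)
...   | yes g₀≤ = inj₂ (zero , U₀ , λ { zero _ → ≤-refl ; (suc w) Uw → ≤-trans g₀≤ (min w Uw) })
...   | no  g₀≰ = inj₂ (suc v , Uv , λ { zero _ → <⇒≤ (≰⇒> g₀≰) ; (suc w) → min w })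

belowAverage : ∀ {m} (U : Fin m → Bool) (g : Fin m → ℕ) → 1 ≤ count U →
  Σ (Fin m) λ v → U v ≡ true × g v * count U ≤ ∑[ w < m ] (𝟙 (U w) * g w)
belowAverage {m} U g nonempty with minimum U g
... | inj₁ none = contradiction (≤-trans nonempty (≤-reflexive (count-none U none))) λ ()
... | inj₂ (v , Uv , min) = v , Uv , (begin
  g v * count U                   ≡⟨ *-distribˡ-sum (g v) (𝟙 ∘ U) ⟩
  ∑[ w < m ] (g v * 𝟙 (U w))      ≤⟨ sum-mono (λ w → weighted (U w) (min w)) ⟩
  ∑[ w < m ] (𝟙 (U w) * g w)      ∎)
  where
  open ≤-Reasoning
  weighted : ∀ {x y} b → (b ≡ true → x ≤ y) → x * 𝟙 b ≤ 𝟙 b * y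
  weighted {x} true  x≤y = ≤-trans (≤-reflexive (*-identityʳ x)) (≤-trans (x≤y refl) (≤-reflexive (sym (+-identityʳ _))))
  weighted {x} false _   = ≤-reflexive (*-zeroʳ x)

module _ {n : ℕ} (G : Digraph n) where

  N : Bool → Fin n → Fin n → Bool
  N true  = N⁺ G
  N false = N⁻ G

  -- A T_{m+1} in U is counted once from its source and once from its sink,
  -- so the T_m's in the chosen neighbourhoods count every T_{m+1} at most twice.
  neighbourhood-count : ∀ m U (t : Fin n → Bool) →
    ∑[ v < n ] (𝟙 (U v) * TT⁺ G m (U ∩ N (t v) v)) ≤ 2 * TT⁺ G (suc m) U
  neighbourhood-count m U t = begin
    ∑[ v < n ] (𝟙 (U v) * TT⁺ G m (U ∩ N (t v) v))
      ≤⟨ sum-mono (λ v → *-monoʳ-≤ (𝟙 (U v)) (sourceOrSink (t v) v)) ⟩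
    ∑[ v < n ] (𝟙 (U v) * (TT⁺ G m (U ∩ N⁺ G v) + TT⁻ G m (U ∩ N⁻ G v)))
      ≡⟨ sum-cong-≗ (λ v → *-distribˡ-+ (𝟙 (U v)) _ _) ⟩
    ∑[ v < n ] (𝟙 (U v) * TT⁺ G m (U ∩ N⁺ G v) + 𝟙 (U v) * TT⁻ G m (U ∩ N⁻ G v))
      ≡⟨ ∑-distrib-+ (λ v → 𝟙 (U v) * TT⁺ G m (U ∩ N⁺ G v)) _ ⟩
    TT⁺ G (suc m) U + TT⁻ G (suc m) U
      ≡⟨ cong (TT⁺ G (suc m) U +_) (trans (sym (TT⁺≡TT⁻ G (suc m) U)) (sym (+-identityʳ _))) ⟩
    2 * TT⁺ G (suc m) U ∎
    where
    open ≤-Reasoning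
    sourceOrSink : ∀ t v → TT⁺ G m (U ∩ N t v) ≤ TT⁺ G m (U ∩ N⁺ G v) + TT⁻ G m (U ∩ N⁻ G v)
    sourceOrSink true  v = m≤m+n _ _
    sourceOrSink false v = ≤-trans (≤-reflexive (TT⁺≡TT⁻ G m _)) (m≤n+m _ _)

  -- Suppose each v has a chosen neighbourhood
  -- N (t v) v missing at most D vertices.  Starting from U and passing j times
  -- to U ∩ N (t v) v for a v ∈ U whose neighbourhood contains at most the
  -- average number of T_{j+1}'s, one reaches a set W with |W| ≥ |U| - jD whose
  -- edges are few compared to the T_{j+2}'s of U, as long as L ≤ |U| - jD.
  module Greedy (D L : ℕ) (1≤L : 1 ≤ L) (t : Fin n → Bool)
                (missing : ∀ v → n ≤ count (N (t v) v) + D) where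

    loss : ∀ U v → count U ≤ count (U ∩ N (t v) v) + D
    loss U v = +-cancelʳ-≤ (count Nv) (count U) _ (begin
      count U + count Nv            ≤⟨ count-∩ U Nv ⟩
      count (U ∩ Nv) + n            ≤⟨ +-monoʳ-≤ (count (U ∩ Nv)) (missing v) ⟩
      count (U ∩ Nv) + (count Nv + D) ≡⟨ +-assoc (count (U ∩ Nv)) _ _ ⟨
      count (U ∩ Nv) + count Nv + D   ≡⟨ +-comm-middle (count (U ∩ Nv)) (count Nv) D ⟩
      count (U ∩ Nv) + D + count Nv   ∎)
      where
      open ≤-Reasoning
      Nv : Fin n → Bool
      Nv = N (t v) v
      +-comm-middle : ∀ a b c → a + b + c ≡ a + c + b
      +-comm-middle a b c = trans (+-assoc a b c) (trans (cong (a +_) (+-comm b c)) (sym (+-assoc a c b)))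

    neighbourTT : ℕ → (Fin n → Bool) → Fin n → ℕ
    neighbourTT j U w = TT⁺ G (2 + j) (U ∩ N (t w) w)

    stillLarge : ∀ j U v → suc j * D + L ≤ count U → j * D + L ≤ count (U ∩ N (t v) v)
    stillLarge j U v large = +-cancelˡ-≤ D _ _ (begin
      D + (j * D + L)             ≡⟨ +-assoc D (j * D) L ⟨
      suc j * D + L               ≤⟨ large ⟩
      count U                     ≤⟨ loss U v ⟩
      count (U ∩ N (t v) v) + D   ≡⟨ +-comm _ D ⟩
      D + count (U ∩ N (t v) v)   ∎)
      where open ≤-Reasoning

    greedy : ∀ j U → j * D + L ≤ count U →
      Σ (Fin n → Bool) λ W → count U ≤ count W + j * D × TT⁺ G 2 W * L ^ j ≤ 2 ^ j * TT⁺ G (2 + j) U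
    greedy zero    U _ = U , m≤m+n (count U) 0 , ≤-reflexive (trans (*-identityʳ _) (sym (+-identityʳ _)))
    greedy (suc j) U large
      with v , Uv , average ← belowAverage U (neighbourTT j U) (≤-trans 1≤L (≤-trans (m≤n+m L _) large))
      with W , size , sparse ← greedy j (U ∩ N (t v) v) (stillLarge j U v large)
      = W , size′ , sparse′
      where
      open ≤-Reasoning
      size′ : count U ≤ count W + suc j * D
      size′ = begin
        count U                     ≤⟨ loss U v ⟩
        count (U ∩ N (t v) v) + D   ≤⟨ +-monoˡ-≤ D size ⟩
        count W + j * D + D         ≡⟨ +-assoc (count W) (j * D) D ⟩
        count W + (j * D + D)       ≡⟨ cong (count W +_) (+-comm (j * D) D) ⟩
        count W + suc j * D         ∎
      g : Fin n → ℕ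
      g = neighbourTT j U
      sparse′ : TT⁺ G 2 W * L ^ suc j ≤ 2 ^ suc j * TT⁺ G (3 + j) U
      sparse′ = begin
        TT⁺ G 2 W * (L * L ^ j)     ≡⟨ cong (TT⁺ G 2 W *_) (*-comm L (L ^ j)) ⟩
        TT⁺ G 2 W * (L ^ j * L)     ≡⟨ *-assoc (TT⁺ G 2 W) (L ^ j) L ⟨
        TT⁺ G 2 W * L ^ j * L       ≤⟨ *-monoˡ-≤ L sparse ⟩
        2 ^ j * g v * L             ≤⟨ *-monoʳ-≤ (2 ^ j * g v) (≤-trans (m≤n+m L _) large) ⟩
        2 ^ j * g v * count U       ≡⟨ *-assoc (2 ^ j) (g v) (count U) ⟩
        2 ^ j * (g v * count U)     ≤⟨ *-monoʳ-≤ (2 ^ j) average ⟩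
        2 ^ j * ∑[ w < n ] (𝟙 (U w) * g w)   ≤⟨ *-monoʳ-≤ (2 ^ j) (neighbourhood-count (2 + j) U t) ⟩
        2 ^ j * (2 * TT⁺ G (3 + j) U)        ≡⟨ *-assoc (2 ^ j) 2 _ ⟨
        2 ^ j * 2 * TT⁺ G (3 + j) U          ≡⟨ cong (_* TT⁺ G (3 + j) U) (*-comm (2 ^ j) 2) ⟩
        2 ^ suc j * TT⁺ G (3 + j) U          ∎

_⊆_ : ∀ {m} → (Fin m → Bool) → (Fin m → Bool) → Set
W ⊆ P = ∀ u → W u ≡ true → P u ≡ true

_∖_ : ∀ {m} → (Fin m → Bool) → (Fin m → Bool) → (Fin m → Bool)
(P ∖ W) u = P u ∧ not (W u)

sum-const : ∀ m c → ∑[ i < m ] c ≡ m * c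
sum-const zero    c = refl
sum-const (suc m) c = cong (c +_) (sum-const m c)

count-∖ : ∀ {m} {W P : Fin m → Bool} → W ⊆ P → count P ≡ count W + count (P ∖ W)
count-∖ {W = W} {P} W⊆P = trans (sum-cong-≗ (λ u → split (P u) (W u) (W⊆P u))) (∑-distrib-+ (𝟙 ∘ W) (𝟙 ∘ (P ∖ W)))
  where
  split : ∀ p w → (w ≡ true → p ≡ true) → 𝟙 p ≡ 𝟙 w + 𝟙 (p ∧ not w)
  split true  true  _ = refl
  split true  false _ = refl
  split false true  w⇒p = contradiction (w⇒p refl) λ ()
  split false false _ = refl

-- an edge of G[P] lies in G[W] or has an endpoint in P ∖ W
edge-split : ∀ px wx py wy a → 𝟙 (px ∧ (py ∧ a)) ≤ 𝟙 (wx ∧ (wy ∧ a)) + 𝟙 (px ∧ not wx) + 𝟙 (py ∧ not wy)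
edge-split false wx    py    wy    a = z≤n
edge-split true  false py    wy    a = ≤-trans (𝟙≤1 (py ∧ a)) (s≤s z≤n)
edge-split true  true  false wy    a = z≤n
edge-split true  true  true  false a = 𝟙≤1 a
edge-split true  true  true  true  a = ≤-trans (m≤m+n (𝟙 a) 0) (m≤m+n (𝟙 a + 0) 0)

module _ {n : ℕ} (G : Digraph n) where

  edges-∖ : ∀ W P → edges G P ≤ edges G W + n * count (P ∖ W) + n * count (P ∖ W)
  edges-∖ W P = begin
    edges G P
      ≤⟨ sum-mono (λ x → sum-mono (λ y → edge-split (P x) (W x) (P y) (W y) (adj G x y))) ⟩
    ∑[ x < n ] ∑[ y < n ] (𝟙 (W x ∧ (W y ∧ adj G x y)) + 𝟙 (X x) + 𝟙 (X y))
      ≡⟨ sum-cong-≗ (λ x → inner x) ⟩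
    ∑[ x < n ] (count (λ y → W x ∧ (W y ∧ adj G x y)) + n * 𝟙 (X x) + count X)
      ≡⟨ ∑-distrib-+ (λ x → count (λ y → W x ∧ (W y ∧ adj G x y)) + n * 𝟙 (X x)) (λ _ → count X) ⟩
    ∑[ x < n ] (count (λ y → W x ∧ (W y ∧ adj G x y)) + n * 𝟙 (X x)) + ∑[ x < n ] count X
      ≡⟨ cong₂ _+_ (trans (∑-distrib-+ (λ x → count (λ y → W x ∧ (W y ∧ adj G x y))) (λ x → n * 𝟙 (X x)))
                          (cong (edges G W +_) (sym (*-distribˡ-sum n (𝟙 ∘ X)))))
                   (sum-const n (count X)) ⟩
    edges G W + n * count X + n * count X ∎
    where
    open ≤-Reasoning
    X : Fin n → Bool
    X = P ∖ W
    inner : ∀ x → ∑[ y < n ] (𝟙 (W x ∧ (W y ∧ adj G x y)) + 𝟙 (X x) + 𝟙 (X y))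
                ≡ count (λ y → W x ∧ (W y ∧ adj G x y)) + n * 𝟙 (X x) + count X
    inner x = trans (∑-distrib-+ (λ y → 𝟙 (W x ∧ (W y ∧ adj G x y)) + 𝟙 (X x)) (𝟙 ∘ X))
                    (cong (_+ count X) (trans (∑-distrib-+ (λ y → 𝟙 (W x ∧ (W y ∧ adj G x y))) (λ _ → 𝟙 (X x)))
                                              (cong (count (λ y → W x ∧ (W y ∧ adj G x y)) +_) (sum-const n (𝟙 (X x))))))

intermediate-value : (f : ℕ → ℕ) → (∀ k → f (suc k) ≤ f k + 1) →
  ∀ m t → f 0 ≤ t → t ≤ f m → Σ ℕ λ k → f k ≡ t
intermediate-value f step zero    t f0≤t t≤fm = zero , ≤-antisym f0≤t t≤fm
intermediate-value f step (suc m) t f0≤t t≤fm with t ≤? f m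
... | yes t≤f = intermediate-value f step m t f0≤t t≤f
... | no  t≰f = suc m , ≤-antisym (≤-trans (step m) (≤-trans (≤-reflexive (+-comm (f m) 1)) (≰⇒> t≰f))) t≤fm

_∪below_ : ∀ {m} → (Fin m → Bool) → ℕ → (Fin m → Bool)
(W ∪below k) u = W u ∨ (toℕ u <ᵇ k)

count-∪below-0 : ∀ {m} (W : Fin m → Bool) → count (W ∪below 0) ≡ count W
count-∪below-0 W = count-cong (λ u → ∨-identityʳ (W u))

count-∪below-all : ∀ {m} (W : Fin m → Bool) → count (W ∪below m) ≡ m
count-∪below-all {m} W = trans (count-cong (λ u → trans (cong (W u ∨_) (below u)) (∨-zeroʳ (W u)))) (count-all m)
  where
  below : ∀ {m} (u : Fin m) → (toℕ u <ᵇ m) ≡ true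
  below zero    = refl
  below (suc u) = below u

count-∪below-step : ∀ {m} (W : Fin m → Bool) k → count (W ∪below suc k) ≤ count (W ∪below k) + 1
count-∪below-step {m} W k = begin
  count (W ∪below suc k)                                   ≤⟨ sum-mono (λ u → grow (W u) (toℕ u) k) ⟩
  ∑[ u < m ] (𝟙 ((W ∪below k) u) + 𝟙 (toℕ u ≡ᵇ k))         ≡⟨ ∑-distrib-+ (𝟙 ∘ (W ∪below k)) (λ u → 𝟙 (toℕ u ≡ᵇ k)) ⟩
  count (W ∪below k) + count {m} (λ u → toℕ u ≡ᵇ k)         ≤⟨ +-monoʳ-≤ (count (W ∪below k)) (atMostOne {m} k) ⟩
  count (W ∪below k) + 1                                   ∎
  where
  open ≤-Reasoning
  below-suc : ∀ a k → 𝟙 (a <ᵇ suc k) ≤ 𝟙 (a <ᵇ k) + 𝟙 (a ≡ᵇ k)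
  below-suc zero    zero    = ≤-refl
  below-suc zero    (suc k) = s≤s z≤n
  below-suc (suc a) zero    = z≤n
  below-suc (suc a) (suc k) = below-suc a k
  grow : ∀ w a k → 𝟙 (w ∨ (a <ᵇ suc k)) ≤ 𝟙 (w ∨ (a <ᵇ k)) + 𝟙 (a ≡ᵇ k)
  grow true  a k = s≤s z≤n
  grow false a k = below-suc a k
  atMostOne : ∀ {m} k → count {m} (λ u → toℕ u ≡ᵇ k) ≤ 1
  atMostOne {zero}  k       = z≤n
  atMostOne {suc m} zero    = ≤-reflexive (cong suc (count-none {m} (λ u → toℕ (suc u) ≡ᵇ zero) (λ _ → refl)))
  atMostOne {suc m} (suc k) = atMostOne {m} k

superset-of-size : ∀ {m} (W : Fin m → Bool) t → count W ≤ t → t ≤ m →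
  Σ (Fin m → Bool) λ P → W ⊆ P × count P ≡ t
superset-of-size {m} W t W≤t t≤m
  with k , size ← intermediate-value (λ k → count (W ∪below k)) (count-∪below-step W) m t
                    (≤-trans (≤-reflexive (count-∪below-0 W)) W≤t) (≤-trans t≤m (≤-reflexive (sym (count-∪below-all W))))
  = W ∪below k , (λ u Wu → cong (_∨ (toℕ u <ᵇ k)) Wu) , size

≤-+-/ : ∀ m g y q .{{_ : NonZero q}} → m * q ≤ g * q + y → m ≤ g + y / q
≤-+-/ m g y q mq≤ with m ≤? g
... | yes m≤g = ≤-trans m≤g (m≤m+n g _)
... | no  m≰g = subst (_≤ g + y / q) (m+[n∸m]≡n g≤m) (+-monoʳ-≤ g excess≤)
  where
  g≤m : g ≤ m
  g≤m = <⇒≤ (≰⇒> m≰g)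
  excess*q≤y : (m ∸ g) * q ≤ y
  excess*q≤y = +-cancelˡ-≤ (g * q) _ _
    (subst (_≤ g * q + y) (trans (cong (_* q) (sym (m+[n∸m]≡n g≤m))) (*-distribʳ-+ q g (m ∸ g))) mq≤)
  excess≤ : m ∸ g ≤ y / q
  excess≤ = subst (_≤ y / q) (m*n/n≡m (m ∸ g) q) (/-monoˡ-≤ q excess*q≤y)

-- T = ⌈n / K⌉, written ⌊(n + k) / K⌋ with K = k + 1
ceiling-bounds : ∀ n k → (n + k) / suc k * suc k ≤ n + k × n ≤ (n + k) / suc k * suc k
ceiling-bounds n k = m/n*n≤m (n + k) (suc k) , +-cancelʳ-≤ k n (T * suc k) (begin
  n + k                          ≡⟨ m≡m%n+[m/n]*n (n + k) (suc k) ⟩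
  (n + k) % suc k + T * suc k    ≤⟨ +-monoˡ-≤ (T * suc k) (m<1+n⇒m≤n (m%n<n (n + k) (suc k))) ⟩
  k + T * suc k                  ≡⟨ +-comm k (T * suc k) ⟩
  T * suc k + k                  ∎)
  where
  open ≤-Reasoning
  T : ℕ
  T = (n + k) / suc k

^-distrib-* : ∀ x y k → (x * y) ^ k ≡ x ^ k * y ^ k
^-distrib-* x y zero    = refl
^-distrib-* x y (suc k) = trans (cong ((x * y) *_) (^-distrib-* x y k)) (interchange x y (x ^ k) (y ^ k))
  where
  interchange : ∀ x y X Y → (x * y) * (X * Y) ≡ (x * X) * (y * Y)
  interchange = solve-∀

square-bound : ∀ K a b e N → 16 * K * K * a ≤ b → b * e ≤ 4 * K * a * N → b * (e * e) ≤ a * (N * N)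
square-bound K a zero      e N _ _ = z≤n
square-bound K a b@(suc _) e N ε-small e-small = *-cancelˡ-≤ b (begin
  b * (b * (e * e))                    ≡⟨ regroup₁ b e ⟩
  (b * e) * (b * e)                    ≤⟨ *-mono-≤ e-small e-small ⟩
  (4 * K * a * N) * (4 * K * a * N)    ≡⟨ regroup₂ K a N ⟩
  (16 * K * K * a) * (a * (N * N))     ≤⟨ *-monoˡ-≤ (a * (N * N)) ε-small ⟩
  b * (a * (N * N))                    ∎)
  where
  open ≤-Reasoning
  regroup₁ : ∀ b e → b * (b * (e * e)) ≡ (b * e) * (b * e)
  regroup₁ = solve-∀
  regroup₂ : ∀ K a N → (4 * K * a * N) * (4 * K * a * N) ≡ (16 * K * K * a) * (a * (N * N))
  regroup₂ = solve-∀

-- Write K = k + 1 = r - 1, ε = a/b and α = c/d.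
module Core (k a′ b′ c d′ n : ℕ) (G : Digraph n)
  (n-positive : 1 ≤ n) (n-large : 2 * suc b′ ≤ n)
  (ε-small : 16 * suc k * suc k * suc a′ ≤ suc b′)
  (α-small : c * (suc b′ * (4 * suc k) ^ k) ≤ suc d′)
  (degree : ∀ v → Σ Bool λ t →
     (suc k * suc b′) * n ≤ count (N G t v) * (suc k * suc b′) + (suc b′ * n + suc k * suc a′ * n))
  (few-TT : suc d′ * copiesTT (2 + k) G ≤ c * n ^ (2 + k)) where

  K a b d : ℕ
  K = suc k
  a = suc a′
  b = suc b′
  d = suc d′

  -- (P + Q)/(Kb) = (1/K + ε)n bounds the number of vertices missed by the
  -- large neighbourhood of any vertex
  P Q D : ℕ
  P = b * n
  Q = K * a * n
  D = (P + Q) / (K * b)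

  direction : Fin n → Bool
  direction v = proj₁ (degree v)

  missing : ∀ v → n ≤ count (N G (direction v) v) + D
  missing v = ≤-+-/ n Nv (P + Q) (K * b) (subst (_≤ Nv * (K * b) + (P + Q)) (*-comm (K * b) n) (proj₂ (degree v)))
    where
    Nv : ℕ
    Nv = count (N G (direction v) v)

  D-bound : (K * b) * D ≤ P + Q
  D-bound = subst (_≤ P + Q) (*-comm D (K * b)) (m/n*n≤m (P + Q) (K * b))

  Q-small : 16 * K * Q ≤ P
  Q-small = subst (_≤ P) (sym (regroup K a n)) (*-monoˡ-≤ n ε-small)
    where
    regroup : ∀ K a n → 16 * K * (K * a * n) ≡ 16 * K * K * a * n
    regroup = solve-∀

  2kQ≤P : 2 * k * Q ≤ P
  2kQ≤P = ≤-trans (*-monoˡ-≤ Q (≤-trans (*-monoʳ-≤ 2 (n≤1+n k)) (*-monoˡ-≤ K {2} {16} (s≤s (s≤s z≤n))))) Q-small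

  kQ≤P : k * Q ≤ P
  kQ≤P = ≤-trans (*-monoˡ-≤ Q (m≤n*m k 2)) 2kQ≤P

  k*D≤n : k * D ≤ n
  k*D≤n = *-cancelˡ-≤ (K * b) (begin
    (K * b) * (k * D)   ≡⟨ regroup₁ K b k D ⟩
    k * ((K * b) * D)   ≤⟨ *-monoʳ-≤ k D-bound ⟩
    k * (P + Q)         ≡⟨ *-distribˡ-+ k P Q ⟩
    k * P + k * Q       ≤⟨ +-monoʳ-≤ (k * P) kQ≤P ⟩
    k * P + P           ≡⟨ regroup₂ k b n ⟩
    (K * b) * n         ∎)
    where
    open ≤-Reasoning
    regroup₁ : ∀ K b k D → (K * b) * (k * D) ≡ k * ((K * b) * D)
    regroup₁ = solve-∀
    regroup₂ : ∀ k b n → k * (b * n) + b * n ≡ (suc k * b) * n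
    regroup₂ = solve-∀

  -- the lower bound on the sets met by the greedy procedure after k steps
  L : ℕ
  L = n ∸ k * D

  L+kD≡n : L + k * D ≡ n
  L+kD≡n = m∸n+n≡m k*D≤n

  -- KbL ≥ P - kQ, since Kb·kD ≤ k(P + Q)
  P≤KbL+kQ : P ≤ (K * b) * L + k * Q
  P≤KbL+kQ = +-cancelʳ-≤ (k * P) _ _ (begin
    P + k * P                      ≡⟨ regroup₁ k b n ⟩
    (K * b) * n                    ≡⟨ cong ((K * b) *_) L+kD≡n ⟨
    (K * b) * (L + k * D)          ≡⟨ regroup₂ K b L k D ⟩
    (K * b) * L + k * ((K * b) * D) ≤⟨ +-monoʳ-≤ ((K * b) * L) (*-monoʳ-≤ k D-bound) ⟩
    (K * b) * L + k * (P + Q)      ≡⟨ regroup₃ ((K * b) * L) k P Q ⟩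
    (K * b) * L + k * Q + k * P    ∎)
    where
    open ≤-Reasoning
    regroup₁ : ∀ k b n → b * n + k * (b * n) ≡ (suc k * b) * n
    regroup₁ = solve-∀
    regroup₂ : ∀ K b L k D → (K * b) * (L + k * D) ≡ (K * b) * L + k * ((K * b) * D)
    regroup₂ = solve-∀
    regroup₃ : ∀ X k P Q → X + k * (P + Q) ≡ X + k * Q + k * P
    regroup₃ = solve-∀

  n≤2KL : n ≤ 2 * K * L
  n≤2KL = *-cancelˡ-≤ (K * b) (+-cancelʳ-≤ (K * P) _ _ (begin
    (K * b) * n + K * P                ≡⟨ regroup₁ K b n ⟩
    2 * K * P                          ≤⟨ *-monoʳ-≤ (2 * K) P≤KbL+kQ ⟩
    2 * K * ((K * b) * L + k * Q)      ≡⟨ regroup₂ K ((K * b) * L) k Q ⟩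
    2 * K * ((K * b) * L) + K * (2 * k * Q) ≤⟨ +-monoʳ-≤ (2 * K * ((K * b) * L)) (*-monoʳ-≤ K 2kQ≤P) ⟩
    2 * K * ((K * b) * L) + K * P      ≡⟨ cong (_+ K * P) (regroup₃ K b L) ⟩
    (K * b) * (2 * K * L) + K * P      ∎))
    where
    open ≤-Reasoning
    regroup₁ : ∀ K b n → (K * b) * n + K * (b * n) ≡ 2 * K * (b * n)
    regroup₁ = solve-∀
    regroup₂ : ∀ K X k Q → 2 * K * (X + k * Q) ≡ 2 * K * X + K * (2 * k * Q)
    regroup₂ = solve-∀
    regroup₃ : ∀ K b L → 2 * K * ((K * b) * L) ≡ (K * b) * (2 * K * L)
    regroup₃ = solve-∀

  1≤L : 1 ≤ L
  1≤L with L in L≡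
  ... | zero  = contradiction (≤-trans n-positive (≤-trans n≤2KL (≤-reflexive (trans (cong (2 * K *_) L≡) (*-zeroʳ (2 * K)))))) λ ()
  ... | suc _ = s≤s z≤n

  sparseSet : Σ (Fin n → Bool) λ W →
    count {n} (λ _ → true) ≤ count W + k * D × TT⁺ G 2 W * L ^ k ≤ 2 ^ k * TT⁺ G (2 + k) (λ _ → true)
  sparseSet = Greedy.greedy G D L 1≤L direction missing k (λ _ → true)
                (≤-reflexive (trans (+-comm (k * D) L) (trans L+kD≡n (sym (count-all n)))))

  W : Fin n → Bool
  W = proj₁ sparseSet

  W-large : n ≤ count W + k * D
  W-large = subst (_≤ count W + k * D) (count-all n) (proj₁ (proj₂ sparseSet))

  W-sparse : edges G W * L ^ k ≤ 2 ^ k * copiesTT (2 + k) G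
  W-sparse = subst₂ _≤_ (cong (_* L ^ k) (TT⁺2≡edges G W)) (cong (2 ^ k *_) (sym (copiesTT≡TT⁺ G (2 + k))))
                        (proj₂ (proj₂ sparseSet))

  instance
    n≢0 : NonZero n
    n≢0 = >-nonZero n-positive
    dn^k≢0 : NonZero (d * n ^ k)
    dn^k≢0 = >-nonZero (*-mono-< {0} {d} {0} {n ^ k} (s≤s z≤n) (m^n>0 n k))

  -- e(W) ≤ n²/b, using n ≤ 2KL and the bound on the number of T_{k+2}'s
  W-edges : b * edges G W ≤ n * n
  W-edges = *-cancelˡ-≤ (d * n ^ k) (begin
    (d * n ^ k) * (b * e)                       ≡⟨ regroup₁ d (n ^ k) b e ⟩
    b * d * e * n ^ k                           ≤⟨ *-monoʳ-≤ (b * d * e) (^-monoˡ-≤ k n≤2KL) ⟩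
    b * d * e * (2 * K * L) ^ k                 ≡⟨ cong (b * d * e *_) (^-distrib-* (2 * K) L k) ⟩
    b * d * e * ((2 * K) ^ k * L ^ k)           ≡⟨ regroup₂ b d e ((2 * K) ^ k) (L ^ k) ⟩
    b * (2 * K) ^ k * (d * (e * L ^ k))         ≤⟨ *-monoʳ-≤ (b * (2 * K) ^ k) (*-monoʳ-≤ d W-sparse) ⟩
    b * (2 * K) ^ k * (d * (2 ^ k * #TT))       ≡⟨ regroup₃ b ((2 * K) ^ k) d (2 ^ k) #TT ⟩
    b * ((2 * K) ^ k * 2 ^ k) * (d * #TT)       ≤⟨ *-monoʳ-≤ (b * ((2 * K) ^ k * 2 ^ k)) few-TT ⟩
    b * ((2 * K) ^ k * 2 ^ k) * (c * n ^ (2 + k)) ≡⟨ cong (λ x → b * x * (c * n ^ (2 + k))) 4K^k ⟩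
    b * (4 * K) ^ k * (c * n ^ (2 + k))         ≡⟨ regroup₄ b ((4 * K) ^ k) c n (n ^ k) ⟩
    (c * (b * (4 * K) ^ k)) * (n ^ k * (n * n)) ≤⟨ *-monoˡ-≤ (n ^ k * (n * n)) α-small ⟩
    d * (n ^ k * (n * n))                       ≡⟨ *-assoc d (n ^ k) (n * n) ⟨
    (d * n ^ k) * (n * n)                       ∎)
    where
    open ≤-Reasoning
    e #TT : ℕ
    e = edges G W
    #TT = copiesTT (2 + k) G
    4K^k : (2 * K) ^ k * 2 ^ k ≡ (4 * K) ^ k
    4K^k = trans (sym (^-distrib-* (2 * K) 2 k)) (cong (_^ k) (trans (*-comm (2 * K) 2) (sym (*-assoc 2 2 K))))
    regroup₁ : ∀ d N b e → (d * N) * (b * e) ≡ b * d * e * N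
    regroup₁ = solve-∀
    regroup₂ : ∀ b d e X Y → b * d * e * (X * Y) ≡ b * X * (d * (e * Y))
    regroup₂ = solve-∀
    regroup₃ : ∀ b X d Y c → b * X * (d * (Y * c)) ≡ b * (X * Y) * (d * c)
    regroup₃ = solve-∀
    regroup₄ : ∀ b M c n N → b * M * (c * (n * (n * N))) ≡ (c * (b * M)) * (N * (n * n))
    regroup₄ = solve-∀

  -- the conclusion, with e(G[S]) ≤ √ε n² written as b e(G[S])² ≤ a n⁴
  Goal : Set
  Goal = Σ (Subset n) λ S → n ≤ ∣ S ∣ * K × b * (edgesIn G S * edgesIn G S) ≤ a * ((n * n) * (n * n))

  -- any S with |S| ≥ n/K and e(S) ≤ 4Kεn² will do, as 16K²ε ≤ 1
  goal-from : (S : Fin n → Bool) → n ≤ count S * K → b * edges G S ≤ 4 * K * a * (n * n) → Goal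
  goal-from S S-large S-sparse =
    Vec.tabulate S ,
    subst (λ s → n ≤ s * K) (sym (∣tabulate∣ S)) S-large ,
    subst (λ e → b * (e * e) ≤ a * ((n * n) * (n * n))) (sym edges≡)
          (square-bound K a b (edges G S) (n * n) ε-small S-sparse)
    where
    edges≡ : edgesIn G (Vec.tabulate S) ≡ edges G S
    edges≡ = trans (edgesIn≡edges G (Vec.tabulate S)) (edges-cong G (lookup∘tabulate S))

  -- If W is smaller than n/K, enlarge it to a set S of size T = ⌈n/K⌉.  Since
  -- |W| ≥ n - kD ≥ n/K - kεn, at most 1 + kεn vertices are added, each
  -- creating at most 2n edges.
  module Padded (W-small : ¬ (n ≤ count W * K)) where

    T : ℕ
    T = (n + k) / K

    T*K≤n+k : T * K ≤ n + k
    T*K≤n+k = proj₁ (ceiling-bounds n k)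

    n≤T*K : n ≤ T * K
    n≤T*K = proj₂ (ceiling-bounds n k)

    W≤T : count W ≤ T
    W≤T = *-cancelʳ-≤ (count W) T K (≤-trans (<⇒≤ (≰⇒> W-small)) n≤T*K)

    T≤n : T ≤ n
    T≤n = *-cancelʳ-≤ T n K (≤-trans T*K≤n+k (≤-trans (+-monoʳ-≤ n (m≤n*m k n)) (≤-reflexive (sym (*-suc n k)))))

    padding : Σ (Fin n → Bool) λ S → W ⊆ S × count S ≡ T
    padding = superset-of-size W T W≤T T≤n

    S X : Fin n → Bool
    S = proj₁ padding
    X = S ∖ W

    T≡W+X : T ≡ count W + count X
    T≡W+X = trans (sym (proj₂ (proj₂ padding))) (count-∖ (proj₁ (proj₂ padding)))

    X-small : b * count X ≤ b + k * a * n
    X-small = *-cancelˡ-≤ K (≤-trans (+-cancelʳ-≤ (k * P + P) _ _ chain) (≤-trans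
      (+-monoˡ-≤ (k * Q) (≤-trans (≤-reflexive (*-comm b k)) (*-monoˡ-≤ b (n≤1+n k)))) (≤-reflexive (regroup₄ b k a n))))
      where
      open ≤-Reasoning
      x w : ℕ
      x = count X
      w = count W
      KX+KW≤n+k : K * x + K * w ≤ n + k
      KX+KW≤n+k = ≤-trans (≤-reflexive (trans (sym (*-distribˡ-+ K x w))
                    (trans (cong (K *_) (trans (+-comm x w) (sym T≡W+X))) (*-comm K T)))) T*K≤n+k
      regroup₁ : ∀ b x k n → suc k * (b * x) + (k * (b * n) + b * n) ≡ b * (suc k * x) + (suc k * b) * n
      regroup₁ = solve-∀
      regroup₂ : ∀ K b x w k D → b * (K * x) + (K * b) * (w + k * D) ≡ b * (K * x + K * w) + k * ((K * b) * D)
      regroup₂ = solve-∀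
      regroup₃ : ∀ b n k P Q → b * (n + k) + k * (P + Q) ≡ (b * k + k * Q) + (k * P + b * n)
      regroup₃ = solve-∀
      regroup₄ : ∀ b k a n → suc k * b + k * (suc k * a * n) ≡ suc k * (b + k * a * n)
      regroup₄ = solve-∀
      chain : K * (b * x) + (k * P + P) ≤ (b * k + k * Q) + (k * P + P)
      chain = begin
        K * (b * x) + (k * P + P)                 ≡⟨ regroup₁ b x k n ⟩
        b * (K * x) + (K * b) * n                 ≤⟨ +-monoʳ-≤ (b * (K * x)) (*-monoʳ-≤ (K * b) W-large) ⟩
        b * (K * x) + (K * b) * (w + k * D)       ≡⟨ regroup₂ K b x w k D ⟩
        b * (K * x + K * w) + k * ((K * b) * D)   ≤⟨ +-mono-≤ (*-monoʳ-≤ b KX+KW≤n+k) (*-monoʳ-≤ k D-bound) ⟩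
        b * (n + k) + k * (P + Q)                 ≡⟨ regroup₃ b n k P Q ⟩
        (b * k + k * Q) + (k * P + P)             ∎

    -- e(S) ≤ e(W) + 2n|X| ≤ n²/b + 2n(1 + kεn) ≤ 4Kεn²
    S-sparse : b * edges G S ≤ 4 * K * a * (n * n)
    S-sparse = begin
      b * edges G S                                     ≤⟨ *-monoʳ-≤ b (edges-∖ G W S) ⟩
      b * (edges G W + n * count X + n * count X)       ≡⟨ regroup₁ b (edges G W) n (count X) ⟩
      b * edges G W + n * (b * count X) + n * (b * count X)
        ≤⟨ +-mono-≤ (+-mono-≤ W-edges (*-monoʳ-≤ n X-small)) (*-monoʳ-≤ n X-small) ⟩
      n * n + n * (b + k * a * n) + n * (b + k * a * n) ≡⟨ regroup₂ n b k a ⟩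
      n * n + n * (2 * b) + 2 * k * a * (n * n)
        ≤⟨ +-monoˡ-≤ (2 * k * a * (n * n)) (+-mono-≤ (m≤n*m (n * n) a) (≤-trans (*-monoʳ-≤ n n-large) (m≤n*m (n * n) a))) ⟩
      a * (n * n) + a * (n * n) + 2 * k * a * (n * n)   ≡⟨ regroup₃ a k (n * n) ⟩
      2 * K * a * (n * n)                               ≤⟨ *-monoˡ-≤ (n * n) (*-monoˡ-≤ a (*-monoˡ-≤ K {2} {4} (s≤s (s≤s z≤n)))) ⟩
      4 * K * a * (n * n)                               ∎
      where
      open ≤-Reasoning
      regroup₁ : ∀ b e n x → b * (e + n * x + n * x) ≡ b * e + n * (b * x) + n * (b * x)
      regroup₁ = solve-∀
      regroup₂ : ∀ n b k a → n * n + n * (b + k * a * n) + n * (b + k * a * n) ≡ n * n + n * (2 * b) + 2 * k * a * (n * n)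
      regroup₂ = solve-∀
      regroup₃ : ∀ a k N → a * N + a * N + 2 * k * a * N ≡ 2 * suc k * a * N
      regroup₃ = solve-∀

    result : Goal
    result = goal-from S (subst (λ s → n ≤ s * K) (sym (proj₂ (proj₂ padding))) n≤T*K) S-sparse

  result : Goal
  result = byCase (n ≤? count W * K)
    where
    byCase : Dec (n ≤ count W * K) → Goal
    byCase (yes W-large-enough) = goal-from W W-large-enough (≤-trans W-edges (m≤n*m (n * n) (4 * K * a)))
    byCase (no  W-small)        = Padded.result W-small

module Rationals where

  open import Data.Integer as ℤ using (+_; +0; +[1+_]; -[1+_])
  import Data.Integer.Properties as ℤP
  open import Data.Rational using (mkℚ; *≤*; *<*; NonNegative; Positive; nonNegative; 1ℚ)
    renaming (_+_ to _+ℚ_; _-_ to _-ℚ_)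
  open import Data.Rational.Properties
    using (normalize-coprime; toℚᵘ-injective; toℚᵘ-homo-+; toℚᵘ-homo-*; toℚᵘ-fromℚᵘ;
           *-monoʳ-≤-nonNeg; *-cancelˡ-≤-pos)
    renaming (*-comm to *ℚ-comm; *-assoc to *ℚ-assoc; +-monoˡ-≤ to +ℚ-monoˡ-≤)
  import Data.Rational.Unnormalised as U
  import Data.Rational.Unnormalised.Properties as UP
  open import Data.Nat.Coprimality using (Coprime; 1-coprimeTo)
  import Data.Nat.Coprimality as Coprimality

  ℕtoℚ-normal : ∀ m → ℕtoℚ m ≡ mkℚ (+ m) 0 (Coprimality.sym (1-coprimeTo m))
  ℕtoℚ-normal m = normalize-coprime (Coprimality.sym (1-coprimeTo m))

  ℕtoℚ-reflects-≤ : ∀ {m n} → ℕtoℚ m ≤ℚ ℕtoℚ n → m ≤ n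
  ℕtoℚ-reflects-≤ {m} {n} m≤n rewrite ℕtoℚ-normal m | ℕtoℚ-normal n with m≤n
  ... | *≤* m*1≤n*1 = ℤP.drop‿+≤+ (subst₂ ℤ._≤_ (ℤP.*-identityʳ (+ m)) (ℤP.*-identityʳ (+ n)) m*1≤n*1)

  ℕtoℚ-mono-≤ : ∀ {m n} → m ≤ n → ℕtoℚ m ≤ℚ ℕtoℚ n
  ℕtoℚ-mono-≤ {m} {n} m≤n rewrite ℕtoℚ-normal m | ℕtoℚ-normal n =
    *≤* (subst₂ ℤ._≤_ (sym (ℤP.*-identityʳ (+ m))) (sym (ℤP.*-identityʳ (+ n))) (ℤ.+≤+ m≤n))

  ℕtoℚ-nonNeg : ∀ m → NonNegative (ℕtoℚ m)
  ℕtoℚ-nonNeg m = nonNegative (ℕtoℚ-mono-≤ {0} {m} z≤n)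

  toℚᵘ-ℕtoℚ : ∀ m → ℚ.toℚᵘ (ℕtoℚ m) U.≃ U.mkℚᵘ (+ m) 0
  toℚᵘ-ℕtoℚ m = UP.≃-reflexive (cong ℚ.toℚᵘ (ℕtoℚ-normal m))

  ℕtoℚ-homo-+ : ∀ m n → ℕtoℚ (m + n) ≡ ℕtoℚ m +ℚ ℕtoℚ n
  ℕtoℚ-homo-+ m n = toℚᵘ-injective (UP.≃-trans (toℚᵘ-ℕtoℚ (m + n)) (UP.≃-trans sum≃
    (UP.≃-sym (UP.≃-trans (toℚᵘ-homo-+ (ℕtoℚ m) (ℕtoℚ n)) (UP.+-cong (toℚᵘ-ℕtoℚ m) (toℚᵘ-ℕtoℚ n))))))
    where
    sum≃ : U.mkℚᵘ (+ (m + n)) 0 U.≃ (U.mkℚᵘ (+ m) 0 U.+ U.mkℚᵘ (+ n) 0)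
    sum≃ = U.*≡* (trans (ℤP.*-identityʳ _) (trans (ℤP.pos-+ m n)
      (sym (trans (ℤP.*-identityʳ _) (cong₂ ℤ._+_ (ℤP.*-identityʳ (+ m)) (ℤP.*-identityʳ (+ n)))))))

  ℕtoℚ-homo-* : ∀ m n → ℕtoℚ (m * n) ≡ ℕtoℚ m *ℚ ℕtoℚ n
  ℕtoℚ-homo-* m n = toℚᵘ-injective (UP.≃-trans (toℚᵘ-ℕtoℚ (m * n)) (UP.≃-trans product≃
    (UP.≃-sym (UP.≃-trans (toℚᵘ-homo-* (ℕtoℚ m) (ℕtoℚ n)) (UP.*-cong (toℚᵘ-ℕtoℚ m) (toℚᵘ-ℕtoℚ n))))))
    where
    product≃ : U.mkℚᵘ (+ (m * n)) 0 U.≃ (U.mkℚᵘ (+ m) 0 U.* U.mkℚᵘ (+ n) 0)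
    product≃ = U.*≡* (trans (ℤP.*-identityʳ _) (trans (ℤP.pos-* m n) (sym (ℤP.*-identityʳ _))))

  fraction-*-denominator : ∀ a′ b′ .(co : Coprime (suc a′) (suc b′)) →
    mkℚ +[1+ a′ ] b′ co *ℚ ℕtoℚ (suc b′) ≡ ℕtoℚ (suc a′)
  fraction-*-denominator a′ b′ co = toℚᵘ-injective (UP.≃-trans (toℚᵘ-homo-* (mkℚ +[1+ a′ ] b′ co) (ℕtoℚ (suc b′)))
    (UP.≃-trans (UP.*-cong (UP.≃-refl {U.mkℚᵘ +[1+ a′ ] b′}) (toℚᵘ-ℕtoℚ (suc b′)))
    (UP.≃-trans cancel (UP.≃-sym (toℚᵘ-ℕtoℚ (suc a′))))))
    where
    cancel : (U.mkℚᵘ +[1+ a′ ] b′ U.* U.mkℚᵘ (+ suc b′) 0) U.≃ U.mkℚᵘ (+ suc a′) 0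
    cancel = U.*≡* (trans (ℤP.*-identityʳ _) (cong (+[1+ a′ ] ℤ.*_) (cong +_ (sym (*-identityʳ (suc b′))))))

  inverse-*-K : ∀ k → (+ 1 ℚ./ suc k) *ℚ ℕtoℚ (suc k) ≡ 1ℚ
  inverse-*-K k = toℚᵘ-injective (UP.≃-trans (toℚᵘ-homo-* (+ 1 ℚ./ suc k) (ℕtoℚ (suc k)))
    (UP.≃-trans (UP.*-cong (toℚᵘ-fromℚᵘ (U.mkℚᵘ (+ 1) k)) (toℚᵘ-ℕtoℚ (suc k))) cancel))
    where
    cancel : (U.mkℚᵘ (+ 1) k U.* U.mkℚᵘ (+ suc k) 0) U.≃ U.mkℚᵘ (+ 1) 0
    cancel = U.*≡* (trans (ℤP.*-identityʳ _) (trans (ℤP.*-identityˡ _)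
      (trans (cong +_ (sym (*-identityʳ (suc k)))) (sym (ℤP.*-identityˡ _)))))

  degree-bound : ∀ k a′ b′ .(co : Coprime (suc a′) (suc b′)) n deg →
    threshold (2 + k) (mkℚ +[1+ a′ ] b′ co) n ≤ℚ ℕtoℚ deg →
    (suc k * suc b′) * n ≤ deg * (suc k * suc b′) + (suc b′ * n + suc k * suc a′ * n)
  degree-bound k a′ b′ co n deg deg≥ = ℕtoℚ-reflects-≤ (subst₂ _≤ℚ_ (sym lhs≡) (sym rhs≡) cleared)
    where
    ε u Nq Kq bq aq Dq : ℚ
    ε = mkℚ +[1+ a′ ] b′ co
    u = + 1 ℚ./ suc k
    Nq = ℕtoℚ n
    Kq = ℕtoℚ (suc k)
    bq = ℕtoℚ (suc b′)
    aq = ℕtoℚ (suc a′)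
    Dq = ℕtoℚ deg
    instance
      Kb≥0 : NonNegative (Kq *ℚ bq)
      Kb≥0 = subst NonNegative (ℕtoℚ-homo-* (suc k) (suc b′)) (ℕtoℚ-nonNeg (suc k * suc b′))
    cleared : ((1ℚ -ℚ u -ℚ ε) *ℚ Nq) *ℚ (Kq *ℚ bq) +ℚ (bq *ℚ Nq +ℚ (Kq *ℚ aq) *ℚ Nq)
              ≤ℚ Dq *ℚ (Kq *ℚ bq) +ℚ (bq *ℚ Nq +ℚ (Kq *ℚ aq) *ℚ Nq)
    cleared = +ℚ-monoˡ-≤ (bq *ℚ Nq +ℚ (Kq *ℚ aq) *ℚ Nq) (*-monoʳ-≤-nonNeg (Kq *ℚ bq) deg≥)
    open import Data.Rational.Solver using (module +-*-Solver)
    open +-*-Solver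
    expand : ((1ℚ -ℚ u -ℚ ε) *ℚ Nq) *ℚ (Kq *ℚ bq) +ℚ (bq *ℚ Nq +ℚ (Kq *ℚ aq) *ℚ Nq)
             ≡ (Kq *ℚ bq) *ℚ Nq +ℚ (1ℚ -ℚ u *ℚ Kq) *ℚ bq *ℚ Nq +ℚ (aq -ℚ ε *ℚ bq) *ℚ Kq *ℚ Nq
    expand = solve 6 (λ u ε Nq Kq bq aq →
      ((con 1ℚ :- u :- ε) :* Nq) :* (Kq :* bq) :+ (bq :* Nq :+ (Kq :* aq) :* Nq)
      := (Kq :* bq) :* Nq :+ (con 1ℚ :- u :* Kq) :* bq :* Nq :+ (aq :- ε :* bq) :* Kq :* Nq) refl u ε Nq Kq bq aq
    vanish : (Kq *ℚ bq) *ℚ Nq +ℚ (1ℚ -ℚ 1ℚ) *ℚ bq *ℚ Nq +ℚ (aq -ℚ aq) *ℚ Kq *ℚ Nq ≡ (Kq *ℚ bq) *ℚ Nq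
    vanish = solve 4 (λ Nq Kq bq aq →
      (Kq :* bq) :* Nq :+ (con 1ℚ :- con 1ℚ) :* bq :* Nq :+ (aq :- aq) :* Kq :* Nq := (Kq :* bq) :* Nq) refl Nq Kq bq aq
    lhs≡ : ℕtoℚ ((suc k * suc b′) * n) ≡ ((1ℚ -ℚ u -ℚ ε) *ℚ Nq) *ℚ (Kq *ℚ bq) +ℚ (bq *ℚ Nq +ℚ (Kq *ℚ aq) *ℚ Nq)
    lhs≡ = trans (trans (ℕtoℚ-homo-* (suc k * suc b′) n) (cong (_*ℚ Nq) (ℕtoℚ-homo-* (suc k) (suc b′))))
      (sym (trans expand (trans (cong₂ (λ x y → (Kq *ℚ bq) *ℚ Nq +ℚ (1ℚ -ℚ x) *ℚ bq *ℚ Nq +ℚ (aq -ℚ y) *ℚ Kq *ℚ Nq)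
                                       (inverse-*-K k) (fraction-*-denominator a′ b′ co)) vanish)))
    rhs≡ : ℕtoℚ (deg * (suc k * suc b′) + (suc b′ * n + suc k * suc a′ * n))
           ≡ Dq *ℚ (Kq *ℚ bq) +ℚ (bq *ℚ Nq +ℚ (Kq *ℚ aq) *ℚ Nq)
    rhs≡ = trans (ℕtoℚ-homo-+ (deg * (suc k * suc b′)) _)
      (cong₂ _+ℚ_ (trans (ℕtoℚ-homo-* deg (suc k * suc b′)) (cong (Dq *ℚ_) (ℕtoℚ-homo-* (suc k) (suc b′))))
                  (trans (ℕtoℚ-homo-+ (suc b′ * n) (suc k * suc a′ * n))
                         (cong₂ _+ℚ_ (ℕtoℚ-homo-* (suc b′) n)
                                     (trans (ℕtoℚ-homo-* (suc k * suc a′) n) (cong (_*ℚ Nq) (ℕtoℚ-homo-* (suc k) (suc a′)))))))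

  copies-bound : ∀ c′ d′ .(co : Coprime (suc c′) (suc d′)) copies N →
    ℕtoℚ copies ≤ℚ mkℚ +[1+ c′ ] d′ co *ℚ ℕtoℚ N → suc d′ * copies ≤ suc c′ * N
  copies-bound c′ d′ co copies N copies≤ = ℕtoℚ-reflects-≤ (subst₂ _≤ℚ_
    (sym (trans (ℕtoℚ-homo-* (suc d′) copies) (*ℚ-comm dq (ℕtoℚ copies))))
    (trans cancel (sym (ℕtoℚ-homo-* (suc c′) N)))
    (*-monoʳ-≤-nonNeg dq copies≤))
    where
    α dq : ℚ
    α = mkℚ +[1+ c′ ] d′ co
    dq = ℕtoℚ (suc d′)
    instance
      d≥0 : NonNegative dq
      d≥0 = ℕtoℚ-nonNeg (suc d′)
    cancel : (α *ℚ ℕtoℚ N) *ℚ dq ≡ ℕtoℚ (suc c′) *ℚ ℕtoℚ N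
    cancel = trans (*ℚ-assoc α (ℕtoℚ N) dq) (trans (cong (α *ℚ_) (*ℚ-comm (ℕtoℚ N) dq))
               (trans (sym (*ℚ-assoc α dq (ℕtoℚ N))) (cong (_*ℚ ℕtoℚ N) (fraction-*-denominator c′ d′ co))))

  sqrt-independent : ∀ a′ b′ .(co : Coprime (suc a′) (suc b′)) e N⁴ →
    suc b′ * (e * e) ≤ suc a′ * N⁴ → ℕtoℚ e *ℚ ℕtoℚ e ≤ℚ mkℚ +[1+ a′ ] b′ co *ℚ ℕtoℚ N⁴
  sqrt-independent a′ b′ co e N⁴ be²≤aN⁴ = *-cancelˡ-≤-pos bq (subst₂ _≤ℚ_
    (trans (ℕtoℚ-homo-* (suc b′) (e * e)) (cong (bq *ℚ_) (ℕtoℚ-homo-* e e)))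
    (trans (ℕtoℚ-homo-* (suc a′) N⁴) cancel)
    (ℕtoℚ-mono-≤ be²≤aN⁴))
    where
    ε bq : ℚ
    ε = mkℚ +[1+ a′ ] b′ co
    bq = ℕtoℚ (suc b′)
    instance
      b>0 : Positive bq
      b>0 = subst Positive (sym (ℕtoℚ-normal (suc b′))) _
    cancel : ℕtoℚ (suc a′) *ℚ ℕtoℚ N⁴ ≡ bq *ℚ (ε *ℚ ℕtoℚ N⁴)
    cancel = trans (cong (_*ℚ ℕtoℚ N⁴) (sym (fraction-*-denominator a′ b′ co)))
               (trans (cong (_*ℚ ℕtoℚ N⁴) (*ℚ-comm ε bq)) (*ℚ-assoc bq ε (ℕtoℚ N⁴)))

  ≤-unit-fraction : ∀ a′ b′ .(co : Coprime (suc a′) (suc b′)) m →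
    mkℚ +[1+ a′ ] b′ co ≤ℚ mkℚ (+ 1) m (1-coprimeTo (suc m)) → suc a′ * suc m ≤ suc b′
  ≤-unit-fraction a′ b′ co m (*≤* cross) = ≤-trans (ℤP.drop‿+≤+ cross) (≤-reflexive (*-identityˡ (suc b′)))

  degree-cleared : ∀ k a′ b′ .(co : Coprime (suc a′) (suc b′)) n (G : Digraph n) v →
    let ε = mkℚ +[1+ a′ ] b′ co in
    (threshold (2 + k) ε n ≤ℚ ℕtoℚ (outdeg G v)) ⊎ (threshold (2 + k) ε n ≤ℚ ℕtoℚ (indeg G v)) →
    Σ Bool λ t → (suc k * suc b′) * n ≤ count (N G t v) * (suc k * suc b′) + (suc b′ * n + suc k * suc a′ * n)
  degree-cleared k a′ b′ co n G v (inj₁ out) =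
    true , subst (λ deg → (suc k * suc b′) * n ≤ deg * (suc k * suc b′) + (suc b′ * n + suc k * suc a′ * n))
                 (countB-allFin (λ y → adj G v y)) (degree-bound k a′ b′ co n (outdeg G v) out)
  degree-cleared k a′ b′ co n G v (inj₂ in′) =
    false , subst (λ deg → (suc k * suc b′) * n ≤ deg * (suc k * suc b′) + (suc b′ * n + suc k * suc a′ * n))
                  (countB-allFin (λ y → adj G y v)) (degree-bound k a′ b′ co n (indeg G v) in′)

  unitFraction : ℕ → ℚ
  unitFraction m = mkℚ (+ 1) m (1-coprimeTo (suc m))

  unitFraction-positive : ∀ m → 0ℚ <ℚ unitFraction m
  unitFraction-positive m = *<* (ℤ.+<+ (s≤s z≤n))

  ε₀ : ℕ → ℚ
  ε₀ k = unitFraction (16 * suc k * suc k)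

  α₀ : ℕ → ℚ → ℚ
  α₀ k ε = unitFraction (ℚ.↧ₙ ε * (4 * suc k) ^ k)

  fromFractions : ∀ k (ε α : ℚ) → 0ℚ <ℚ ε → 0ℚ <ℚ α → ε ≤ℚ ε₀ k → α ≤ℚ α₀ k ε →
    ∀ n → 2 * ℚ.↧ₙ ε ≤ n → 1 ≤ n → (G : Digraph n) →
    ((x : Fin n) → (threshold (2 + k) ε n ≤ℚ ℕtoℚ (outdeg G x)) ⊎ (threshold (2 + k) ε n ≤ℚ ℕtoℚ (indeg G x))) →
    ℕtoℚ (copiesTT (2 + k) G) ≤ℚ α *ℚ ℕtoℚ (n ^ (2 + k)) →
    Σ (Subset n) λ S → n ≤ ∣ S ∣ * suc k × IsSqrtIndependent G ε S
  fromFractions k (mkℚ +0       _ _) _ (*<* (ℤ.+<+ ()))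
  fromFractions k (mkℚ -[1+ _ ] _ _) _ (*<* ())
  fromFractions k (mkℚ +[1+ _ ] _ _) (mkℚ +0       _ _) _ (*<* (ℤ.+<+ ()))
  fromFractions k (mkℚ +[1+ _ ] _ _) (mkℚ -[1+ _ ] _ _) _ (*<* ())
  fromFractions k (mkℚ +[1+ a′ ] b′ co) (mkℚ +[1+ c′ ] d′ co₂) _ _ ε≤ε₀ α≤α₀ n n-large n-positive G degree few
    = let S , S-large , S-sparse = Core.result k a′ b′ (suc c′) d′ n G n-positive n-large ε-small α-small
                                     (λ v → degree-cleared k a′ b′ co n G v (degree v))
                                     (copies-bound c′ d′ co₂ (copiesTT (2 + k) G) (n ^ (2 + k)) few)
      in S , S-large , sqrt-independent a′ b′ co (edgesIn G S) ((n * n) * (n * n)) S-sparse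
    where
    ε-small : 16 * suc k * suc k * suc a′ ≤ suc b′
    ε-small = ≤-trans (≤-trans (≤-reflexive (*-comm m (suc a′))) (*-monoʳ-≤ (suc a′) (n≤1+n m)))
                      (≤-unit-fraction a′ b′ co m ε≤ε₀)
      where
      m : ℕ
      m = 16 * suc k * suc k
    α-small : suc c′ * (suc b′ * (4 * suc k) ^ k) ≤ suc d′
    α-small = ≤-trans (*-monoʳ-≤ (suc c′) (n≤1+n m)) (≤-unit-fraction c′ d′ co₂ m α≤α₀)
      where
      m : ℕ
      m = suc b′ * (4 * suc k) ^ k

open Rationals using (ε₀; α₀; unitFraction-positive; fromFractions)

-- Take ε₀ = 1/(16K² + 1), α₀ = 1/(b(4K)^{r-2} + 1) and n₀ = 2b, b the denominator of ε.
proposition6p6 : (r : ℕ) → 2 ≤ r →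
    Σ ℚ λ ε₀ → 0ℚ <ℚ ε₀ × ((ε : ℚ) → 0ℚ <ℚ ε → ε ≤ℚ ε₀ →
    Σ ℚ λ α₀ → 0ℚ <ℚ α₀ × ((α : ℚ) → 0ℚ <ℚ α → α ≤ℚ α₀ →
    Σ ℕ λ n₀ → (n : ℕ) → n₀ ≤ n → 1 ≤ n → (G : Digraph n) →
      ((x : Fin n) → (threshold r ε n ≤ℚ ℕtoℚ (outdeg G x)) ⊎ (threshold r ε n ≤ℚ ℕtoℚ (indeg G x))) →
      ℕtoℚ (copiesTT r G) ≤ℚ α *ℚ ℕtoℚ (n ^ r) →
      Σ (Subset n) λ S → n ≤ ∣ S ∣ * (r ∸ 1) × IsSqrtIndependent G ε S))
proposition6p6 (suc zero)    (s≤s ())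
proposition6p6 (suc (suc k)) _ =
  ε₀ k , unitFraction-positive _ , λ ε ε>0 ε≤ε₀ →
  α₀ k ε , unitFraction-positive _ , λ α α>0 α≤α₀ →
  2 * ℚ.↧ₙ ε , fromFractions k ε α ε>0 α>0 ε≤ε₀ α≤α₀
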